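{- Let $A$ be a commutative ring with identity and $HA$ the ring of Hurwitz series over $A$. Let $n\in\mathbb{N}^+$ be fixed, $z_0,\dots,z_{n-1}\in HA$ and $z=\mathrm{intl}(z_0,\dots,z_{n-1})$. Then $$\langle 1\rangle\, z=\int\mathrm{intl}\Big(1_n\boxdot z_0,\ \dots,\ (i+1)_n\boxdot z_i,\ \dots,\ n_n\boxdot z_{n-1}\Big).$$
   Context: $HA$ is the set of sequences $f=(f(0),f(1),\dots)$ with entries in $A$, with componentwise addition and product $(fg)(m)=\sum_{i=0}^m\binom{m}{i}f(i)g(m-i)$. The integral is $\int f=(0,f(0),f(1),\dots)$. $\langle 1\rangle=(0,1,0,0,\dots)$. For fixed $n$, $\widehat{q}=\lfloor q/n\rfloor$, $\overline{q}=q-\widehat{q}n$; the interlacing is $\mathrm{intl}(z_0,\dots,z_{n-1})(q)=z_{\overline{q}}(\widehat{q})$. The Hadamard product is $(f\boxdot g)(p)=f(p)g(p)$. For $1\le\tau\le n$, $\tau_n\in HA$ is defined by $\tau_n(k)=kn+\tau$. -}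

module Defs where

open import Level using (Level)
open import Data.Nat as ℕ using (ℕ; zero; suc; NonZero)
open import Data.Nat.DivMod using (_/_; _%_; m%n<n)
open import Data.Nat.Combinatorics using (_C_)
open import Data.Fin using (Fin; fromℕ<; toℕ)
open import Algebra.Bundles using (CommutativeRing)

module Hurwitz {c ℓ : Level} (A : CommutativeRing c ℓ) where
  open CommutativeRing A

  HA : Set c
  HA = ℕ → Carrier

  _≈H_ : HA → HA → Set ℓ
  f ≈H g = ∀ m → f m ≈ g m

  ι : ℕ → Carrier
  ι zero = 0#
  ι (suc k) = 1# + ι k

  sumTo : ℕ → (ℕ → Carrier) → Carrier
  sumTo zero t = t 0
  sumTo (suc m) t = sumTo m t + t (suc m)

  _·H_ : HA → HA → HA
  (f ·H g) m = sumTo m (λ i → ι (m C i) * (f i * g (m ℕ.∸ i)))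

  ∫ : HA → HA
  ∫ f zero = 0#
  ∫ f (suc m) = f m

  ⟨1⟩ : HA
  ⟨1⟩ (suc zero) = 1#
  ⟨1⟩ _ = 0#

  _⊡_ : HA → HA → HA
  (f ⊡ g) p = f p * g p

  _[_]ₙ : ℕ → ℕ → HA
  (τ [ n ]ₙ) k = ι (k ℕ.* n ℕ.+ τ)

  intl : (n : ℕ) .{{_ : NonZero n}} → (Fin n → HA) → HA
  intl n z q = z (fromℕ< (m%n<n q n)) (q / n)

-- Multiplying by ⟨1⟩ shifts a Hurwitz series and weights it by the index:
-- (⟨1⟩ f)(k+1) = (k+1) f(k), since C(k+1,1) = k+1 and ⟨1⟩ vanishes off 1.
-- For f = intl(z₀,…,z_{n-1}) the index k+1 of f(k) = z_{k mod n}(k div n) is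
-- (k div n) n + (k mod n) + 1, which is exactly the weight contributed by the
-- Hadamard factor (i+1)ₙ at position k div n of the i-th component.
module Submission where

open import Defs
open import Level using (Level)
open import Data.Nat as ℕ using (ℕ; zero; suc; NonZero)
open import Data.Nat.Properties using (+-suc; +-comm)
open import Data.Nat.DivMod using (_/_; _%_; m%n<n; m≡m%n+[m/n]*n)
open import Data.Nat.Combinatorics using (_C_; nC1≡n)
open import Data.Fin using (Fin; toℕ; fromℕ<)
open import Data.Fin.Properties using (toℕ-fromℕ<)
open import Algebra.Bundles using (CommutativeRing)
open import Relation.Binary.PropositionalEquality as ≡ using (_≡_; cong)

[m/n]*n+suc[m%n]≡suc[m] : ∀ m n .{{_ : NonZero n}} →
  (m / n) ℕ.* n ℕ.+ suc (toℕ (fromℕ< (m%n<n m n))) ≡ suc m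
[m/n]*n+suc[m%n]≡suc[m] m n = begin
  (m / n) ℕ.* n ℕ.+ suc (toℕ (fromℕ< (m%n<n m n))) ≡⟨ cong (λ r → (m / n) ℕ.* n ℕ.+ suc r) (toℕ-fromℕ< (m%n<n m n)) ⟩
  (m / n) ℕ.* n ℕ.+ suc (m % n)                     ≡⟨ +-suc ((m / n) ℕ.* n) (m % n) ⟩
  suc ((m / n) ℕ.* n ℕ.+ m % n)                     ≡⟨ cong suc (+-comm ((m / n) ℕ.* n) (m % n)) ⟩
  suc (m % n ℕ.+ (m / n) ℕ.* n)                     ≡⟨ cong suc (m≡m%n+[m/n]*n m n) ⟨
  suc m                                             ∎
  where open ≡.≡-Reasoning

module HurwitzProperties {c ℓ : Level} (A : CommutativeRing c ℓ) where
  open CommutativeRing A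
  open Hurwitz A
  open import Relation.Binary.Reasoning.Setoid setoid

  ι-cong : ∀ {k l} → k ≡ l → ι k ≈ ι l
  ι-cong ≡.refl = refl

  ∫-cong : ∀ {f g} → f ≈H g → ∫ f ≈H ∫ g
  ∫-cong f≈g zero    = refl
  ∫-cong f≈g (suc m) = f≈g m

  sumTo-concentrated-at-1 : (t : ℕ → Carrier) → t 0 ≈ 0# → (∀ j → t (suc (suc j)) ≈ 0#) →
                            ∀ m → sumTo (suc m) t ≈ t 1
  sumTo-concentrated-at-1 t t0≈0 t≥2≈0 zero = begin
    t 0 + t 1 ≈⟨ +-congʳ t0≈0 ⟩
    0# + t 1  ≈⟨ +-identityˡ (t 1) ⟩
    t 1       ∎
  sumTo-concentrated-at-1 t t0≈0 t≥2≈0 (suc m) = begin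
    sumTo (suc m) t + t (suc (suc m)) ≈⟨ +-cong (sumTo-concentrated-at-1 t t0≈0 t≥2≈0 m) (t≥2≈0 m) ⟩
    t 1 + 0#                          ≈⟨ +-identityʳ (t 1) ⟩
    t 1                               ∎

  ⟨1⟩·H≈∫ : ∀ f → (⟨1⟩ ·H f) ≈H ∫ (λ k → ι (suc k) * f k)
  ⟨1⟩·H≈∫ f zero = begin
    ι 1 * (0# * f 0) ≈⟨ *-congˡ (zeroˡ (f 0)) ⟩
    ι 1 * 0#         ≈⟨ zeroʳ (ι 1) ⟩
    0#               ∎
  ⟨1⟩·H≈∫ f (suc k) = begin
    sumTo (suc k) t            ≈⟨ sumTo-concentrated-at-1 t annihilated (λ _ → annihilated) k ⟩
    ι (suc k C 1) * (1# * f k) ≈⟨ *-cong (ι-cong (nC1≡n (suc k))) (*-identityˡ (f k)) ⟩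
    ι (suc k) * f k            ∎
    where
    t : ℕ → Carrier
    t i = ι (suc k C i) * (⟨1⟩ i * f (suc k ℕ.∸ i))
    annihilated : ∀ {a b} → a * (0# * b) ≈ 0#
    annihilated {a} {b} = trans (*-congˡ (zeroˡ b)) (zeroʳ a)

  intl-⊡[1+i]ₙ≈ι[1+k]*intl : ∀ n .{{_ : NonZero n}} (z : Fin n → HA) →
    intl n (λ i → (suc (toℕ i) [ n ]ₙ) ⊡ z i) ≈H (λ k → ι (suc k) * intl n z k)
  intl-⊡[1+i]ₙ≈ι[1+k]*intl n z k = *-congʳ (ι-cong ([m/n]*n+suc[m%n]≡suc[m] k n))

corollary3p5 : {c ℓ : Level} (A : CommutativeRing c ℓ) → let open Hurwitz A in
    (n : ℕ) .{{_ : NonZero n}} (z : Fin n → HA) →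
    (⟨1⟩ ·H intl n z) ≈H ∫ (intl n (λ i → (suc (toℕ i) [ n ]ₙ) ⊡ z i))
corollary3p5 A n z m = trans (⟨1⟩·H≈∫ (intl n z) m) (sym (∫-cong (intl-⊡[1+i]ₙ≈ι[1+k]*intl n z) m))
  where
  open CommutativeRing A using (trans; sym)
  open Hurwitz A
  open HurwitzProperties A
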